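{- For integers $n, m \geq 0$, let $D^e_{2,2}(n, m)$ be the number of partitions of $n$ into $m$ parts $\lambda_1 \leq \cdots \leq \lambda_m$ such that $\lambda_{i+1} - \lambda_i \geq 2$ for all $i$, and $\lambda_{i+1} - \lambda_i \geq 3$ unless $\lambda_i$ and $\lambda_{i+1}$ are both even. Then \[ \sum_{m, n \geq 0} D^e_{2,2}(n, m) q^n x^m = \sum_{n_1, n_2 \geq 0} \frac{ q^{4n_2^2 + 2n_2 + (3n_1^2 + n_1)/2 + 4n_2 n_1} (1 + xq^{4n_2 + 2n_1 + 1}) x^{2n_2 + n_1} }{ (q; q)_{n_1} (q^4; q^4)_{n_2} }. \]
   Context: A partition of $n$ into $m$ parts is a non-decreasing sequence of $m$ positive integers summing to $n$. For $n \geq 0$, $(a; q)_n = \prod_{j=1}^{n} (1 - a q^{j-1})$, with the empty product equal to $1$. -}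

module Defs where

open import Data.Nat as ℕ using (ℕ; zero; suc; _∸_; _≤ᵇ_; _≡ᵇ_; _%_)
open import Data.Integer as ℤ using (ℤ; +_; -_)
open import Data.Bool using (Bool; true; false; _∧_; _∨_; if_then_else_)
open import Data.List using (List; []; _∷_; _++_; map; concatMap; upTo; length; filterᵇ)
open import Data.Nat.ListAction using (sum)

allLists : ℕ → ℕ → List (List ℕ)
allLists zero    k = [] ∷ []
allLists (suc m) k = concatMap (λ a → map (a ∷_) (allLists m k)) (map suc (upTo k))

isEven : ℕ → Bool
isEven a = a % 2 ≡ᵇ 0

gapOK : ℕ → ℕ → Bool
gapOK a b = (a ℕ.+ 2 ≤ᵇ b) ∧ ((a ℕ.+ 3 ≤ᵇ b) ∨ (isEven a ∧ isEven b))

good : List ℕ → Bool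
good []           = true
good (a ∷ [])     = true
good (a ∷ b ∷ l)  = gapOK a b ∧ good (b ∷ l)

-- number of partitions of n into m parts (λ_1 ≤ … ≤ λ_m, positive, sum n)
-- satisfying the difference conditions; non-decreasingness is implied by gap ≥ 2.
D : ℕ → ℕ → ℕ
D n m = length (filterᵇ (λ l → (sum l ≡ᵇ n) ∧ good l) (allLists m n))

sumTo : ℕ → (ℕ → ℤ) → ℤ
sumTo zero    f = f 0
sumTo (suc n) f = sumTo n f ℤ.+ f (suc n)

-- power series in q: coefficient of q^n
Ser : Set
Ser = ℕ → ℤ

oneS : Ser
oneS zero    = + 1
oneS (suc _) = + 0

monoS : ℕ → Ser
monoS k n = if n ≡ᵇ k then + 1 else + 0

subS : Ser → Ser → Ser
subS f g n = f n ℤ.- g n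

mulS : Ser → Ser → Ser
mulS f g n = sumTo n (λ k → f k ℤ.* g (n ∸ k))

lookupD : List ℤ → ℕ → ℤ
lookupD []      _       = + 0
lookupD (x ∷ _) zero    = x
lookupD (_ ∷ l) (suc n) = lookupD l n

-- coefficients c_0, …, c_n of the multiplicative inverse of a series f
-- with f 0 = 1:  c_0 = 1,  c_{n+1} = - Σ_{j=1}^{n+1} f_j c_{n+1-j}
invUpTo : Ser → ℕ → List ℤ
invUpTo f zero    = + 1 ∷ []
invUpTo f (suc n) = prev ++ ((- sumTo n (λ k → f (suc k) ℤ.* lookupD prev (n ∸ k))) ∷ [])
  where prev = invUpTo f n

invS : Ser → Ser
invS f n = lookupD (invUpTo f n) n

-- (q^b ; q^a)_n = Π_{j=1}^{n} (1 - q^b q^{a(j-1)})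
poch : ℕ → ℕ → ℕ → Ser
poch b a zero    = oneS
poch b a (suc n) = mulS (poch b a n) (subS oneS (monoS (b ℕ.+ a ℕ.* n)))

-- bivariate series: coefficient of x^m q^n
Ser2 : Set
Ser2 = ℕ → ℕ → ℤ

one2 : Ser2
one2 zero    = oneS
one2 (suc _) = λ _ → + 0

mono2 : ℕ → ℕ → Ser2
mono2 i j m n = if (m ≡ᵇ i) ∧ (n ≡ᵇ j) then + 1 else + 0

add2 : Ser2 → Ser2 → Ser2
add2 F G m n = F m n ℤ.+ G m n

mul2 : Ser2 → Ser2 → Ser2
mul2 F G m n = sumTo m (λ i → sumTo n (λ j → F i j ℤ.* G (m ∸ i) (n ∸ j)))

liftQ : Ser → Ser2
liftQ s zero    = s
liftQ s (suc _) = λ _ → + 0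

term : ℕ → ℕ → Ser2
term n₁ n₂ =
  mul2 (mono2 (2 ℕ.* n₂ ℕ.+ n₁)
              (4 ℕ.* n₂ ℕ.* n₂ ℕ.+ 2 ℕ.* n₂ ℕ.+ (3 ℕ.* n₁ ℕ.* n₁ ℕ.+ n₁) ℕ./ 2 ℕ.+ 4 ℕ.* n₂ ℕ.* n₁))
   (mul2 (add2 one2 (mono2 1 (4 ℕ.* n₂ ℕ.+ 2 ℕ.* n₁ ℕ.+ 1)))
         (liftQ (mulS (invS (poch 1 1 n₁)) (invS (poch 4 4 n₂)))))

-- coefficient of x^m q^n in the double sum; the (n1,n2) summand only involves
-- powers x^k with k ≥ 2 n2 + n1, so only n1, n2 ≤ m contribute.
rhsCoeff : ℕ → ℕ → ℤ
rhsCoeff m n = sumTo m (λ n₁ → sumTo m (λ n₂ → term n₁ n₂ m n))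

module Submission where

-- Let G s m be the generating function of the admissible partitions into m parts whose smallest
-- part is at least s.  Splitting off the case where the smallest part equals s gives
-- G s (m+1) = q^s G (s + 2 + s mod 2) m + G (s+1) (m+1), and adding 2 to every part (which keeps all
-- parities) gives G (s+3) m = q^(2m) G (s+1) m.  Together these yield
--   G 1 m = G 2 m + q^(2m-1) G 2 (m-1)  and  (1 - q^(2m)) G 2 m = (q^(2m) + q^(4m-1)) G 2 (m-1),
-- and the second relation determines G 2 from G 2 0 = 1.  On the other side the coefficient of x^m
-- is B m + q^(2m-1) B (m-1), where B m collects the terms q^E / ((q;q)_n₁ (q⁴;q⁴)_n₂) with
-- 2n₂ + n₁ = m.  Writing 1 - q^(2m) = (1 - q^n₁) + q^(n₁+4n₂) (1 - q^n₁) + q^n₁ (1 - q^(4n₂)) and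
-- cancelling each factor against the last factor of a q-Pochhammer symbol shows that B satisfies
-- the same recursion as G 2, so G 2 = B.

open import Defs
open import Data.Nat using (ℕ)
open import Data.Integer using (+_)
open import Relation.Binary.PropositionalEquality using (_≡_)

open import Data.Bool using (Bool; true; false; T; _∧_; _∨_)
import Data.Bool.Properties as 𝔹ₚ
open import Data.Empty using (⊥-elim)
open import Data.Integer as ℤ using (ℤ; 0ℤ; 1ℤ; -_)
import Data.Integer.Properties as ℤₚ
open import Data.Integer.Solver using (module +-*-Solver)
open import Data.List using (List; []; _∷_; _++_; length; map; concatMap; upTo; filterᵇ; applyUpTo)
import Data.List.Properties as Listₚ
open import Data.Nat as ℕ
  using (zero; suc; _+_; _*_; _∸_; _≤_; _<_; _≤ᵇ_; _<ᵇ_; _≡ᵇ_; _%_; z≤n; s≤s; _≟_; _≤?_)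
open import Data.Nat.DivMod using (+-distrib-/-∣ʳ; m*n/n≡m; [m+n]%n≡m%n; m%n<n)
open import Data.Nat.Divisibility using (divides)
open import Data.Nat.Induction using (<-rec)
open import Data.Nat.ListAction using (sum)
import Data.Nat.Properties as ℕₚ
open import Data.Nat.Tactic.RingSolver using (solve-∀)
open import Data.Sum using (_⊎_; inj₁; inj₂)
open import Data.Unit using (tt)
open import Function using (_∘_)
open import Relation.Binary.PropositionalEquality
  using (_≢_; refl; sym; trans; cong; cong₂; subst; _≗_; module ≡-Reasoning)
open import Relation.Nullary using (yes; no)
open import Relation.Nullary.Decidable using (T?)

open +-*-Solver using (solve; _:+_; _:-_; :-_; _:*_; _:=_; con)
open import Algebra.Properties.AbelianGroup ℤₚ.+-0-abelianGroup using (inverseˡ-unique)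
open import Algebra.Properties.CommutativeSemigroup ℤₚ.+-commutativeSemigroup using (interchange)

sumTo-cong : ∀ n {f g : ℕ → ℤ} → (∀ k → k ≤ n → f k ≡ g k) → sumTo n f ≡ sumTo n g
sumTo-cong zero    f≡g = f≡g 0 z≤n
sumTo-cong (suc n) f≡g = cong₂ ℤ._+_ (sumTo-cong n (λ k → f≡g k ∘ ℕₚ.m≤n⇒m≤1+n)) (f≡g (suc n) ℕₚ.≤-refl)

sumTo-zero : ∀ n {f : ℕ → ℤ} → (∀ k → k ≤ n → f k ≡ 0ℤ) → sumTo n f ≡ 0ℤ
sumTo-zero zero    f≡0 = f≡0 0 z≤n
sumTo-zero (suc n) f≡0 = cong₂ ℤ._+_ (sumTo-zero n (λ k → f≡0 k ∘ ℕₚ.m≤n⇒m≤1+n)) (f≡0 (suc n) ℕₚ.≤-refl)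

sumTo-+ : ∀ n (f g : ℕ → ℤ) → sumTo n (λ k → f k ℤ.+ g k) ≡ sumTo n f ℤ.+ sumTo n g
sumTo-+ zero    f g = refl
sumTo-+ (suc n) f g =
  trans (cong (ℤ._+ (f (suc n) ℤ.+ g (suc n))) (sumTo-+ n f g))
        (interchange (sumTo n f) (sumTo n g) (f (suc n)) (g (suc n)))

sumTo-neg : ∀ n (f : ℕ → ℤ) → sumTo n (λ k → - f k) ≡ - sumTo n f
sumTo-neg zero    f = refl
sumTo-neg (suc n) f =
  trans (cong (ℤ._+ - f (suc n)) (sumTo-neg n f)) (sym (ℤₚ.neg-distrib-+ (sumTo n f) (f (suc n))))

sumTo-- : ∀ n (f g : ℕ → ℤ) → sumTo n (λ k → f k ℤ.- g k) ≡ sumTo n f ℤ.- sumTo n g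
sumTo-- n f g = trans (sumTo-+ n f (λ k → - g k)) (cong (λ x → sumTo n f ℤ.+ x) (sumTo-neg n g))

sumTo-suc : ∀ n (f : ℕ → ℤ) → sumTo (suc n) f ≡ f 0 ℤ.+ sumTo n (f ∘ suc)
sumTo-suc zero    f = refl
sumTo-suc (suc n) f =
  trans (cong (ℤ._+ f (suc (suc n))) (sumTo-suc n f)) (ℤₚ.+-assoc (f 0) _ _)

sumTo-reverse : ∀ n (f : ℕ → ℤ) → sumTo n f ≡ sumTo n (λ k → f (n ∸ k))
sumTo-reverse zero    f = refl
sumTo-reverse (suc n) f = begin
  sumTo n f ℤ.+ f (suc n)                   ≡⟨ cong (ℤ._+ f (suc n)) (sumTo-reverse n f) ⟩
  sumTo n (λ k → f (n ∸ k)) ℤ.+ f (suc n)   ≡⟨ ℤₚ.+-comm _ (f (suc n)) ⟩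
  f (suc n) ℤ.+ sumTo n (λ k → f (n ∸ k))   ≡⟨ sym (sumTo-suc n (λ k → f (suc n ∸ k))) ⟩
  sumTo (suc n) (λ k → f (suc n ∸ k))       ∎
  where open ≡-Reasoning

sumTo-comm : ∀ n m (F : ℕ → ℕ → ℤ) →
             sumTo n (λ i → sumTo m (F i)) ≡ sumTo m (λ j → sumTo n (λ i → F i j))
sumTo-comm zero    m F = refl
sumTo-comm (suc n) m F =
  trans (cong (ℤ._+ sumTo m (F (suc n))) (sumTo-comm n m F))
        (sym (sumTo-+ m (λ j → sumTo n (λ i → F i j)) (F (suc n))))

sumTo-single : ∀ n s {f : ℕ → ℤ} → s ≤ n → (∀ k → k ≤ n → k ≢ s → f k ≡ 0ℤ) →
               sumTo n f ≡ f s
sumTo-single zero    .zero z≤n others = refl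
sumTo-single (suc n) s {f} s≤1+n others with s ≟ suc n
... | yes refl =
  trans (cong (ℤ._+ f s) (sumTo-zero n (λ k k≤n → others k (ℕₚ.m≤n⇒m≤1+n k≤n) (ℕₚ.<⇒≢ (s≤s k≤n)))))
        (ℤₚ.+-identityˡ (f s))
... | no s≢1+n =
  trans (cong₂ ℤ._+_ (sumTo-single n s (ℕₚ.≤-pred (ℕₚ.≤∧≢⇒< s≤1+n s≢1+n))
                                     (λ k k≤n → others k (ℕₚ.m≤n⇒m≤1+n k≤n)))
                     (others (suc n) ℕₚ.≤-refl (s≢1+n ∘ sym)))
        (ℤₚ.+-identityʳ (f s))

sumTo-dropLast : ∀ n (f : ℕ → ℤ) → f (suc n) ≡ 0ℤ → sumTo (suc n) f ≡ sumTo n f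
sumTo-dropLast n f f[1+n]≡0 = trans (cong (λ x → sumTo n f ℤ.+ x) f[1+n]≡0) (ℤₚ.+-identityʳ _)

sumTo-extend : ∀ d n (f : ℕ → ℤ) → (∀ k → n < k → k ≤ d + n → f k ≡ 0ℤ) →
               sumTo (d + n) f ≡ sumTo n f
sumTo-extend zero    n f vanish = refl
sumTo-extend (suc d) n f vanish =
  trans (sumTo-dropLast (d + n) f (vanish (suc (d + n)) (s≤s (ℕₚ.m≤n+m n d)) ℕₚ.≤-refl))
        (sumTo-extend d n f (λ k n<k → vanish k n<k ∘ ℕₚ.m≤n⇒m≤1+n))

-- Power series in q

≗-by-strong-induction : {f g : ℕ → ℤ} → (∀ n → (∀ {i} → i < n → f i ≡ g i) → f n ≡ g n) →
                        f ≗ g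
≗-by-strong-induction {f} {g} step = <-rec (λ n → f n ≡ g n) step

0ˢ : Ser
0ˢ _ = 0ℤ

infixl 6 _+ˢ_
_+ˢ_ : Ser → Ser → Ser
(f +ˢ g) n = f n ℤ.+ g n

infixr 8 q^_·_ 1-q^_·_

q^_·_ : ℕ → Ser → Ser
q^ zero  · f             = f
(q^ suc k · f) zero    = 0ℤ
(q^ suc k · f) (suc n) = (q^ k · f) n

1-q^_·_ : ℕ → Ser → Ser
1-q^ d · f = subS f (q^ d · f)

q^·-above : ∀ k f n → k ≤ n → (q^ k · f) n ≡ f (n ∸ k)
q^·-above zero    f n       _         = refl
q^·-above (suc k) f (suc n) (s≤s k≤n) = q^·-above k f n k≤n

q^·-below : ∀ k f n → n < k → (q^ k · f) n ≡ 0ℤ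
q^·-below (suc k) f zero    _         = refl
q^·-below (suc k) f (suc n) (s≤s n<k) = q^·-below k f n n<k

q^·-exponent : ∀ {a b} f → a ≡ b → q^ a · f ≗ q^ b · f
q^·-exponent f refl n = refl

q^·-q^· : ∀ a b f → q^ a · q^ b · f ≗ q^ (a + b) · f
q^·-q^· zero    b f n       = refl
q^·-q^· (suc a) b f zero    = refl
q^·-q^· (suc a) b f (suc n) = q^·-q^· a b f n

q^·-comm : ∀ a b f → q^ a · q^ b · f ≗ q^ b · q^ a · f
q^·-comm a b f n =
  trans (q^·-q^· a b f n) (trans (q^·-exponent f (ℕₚ.+-comm a b) n) (sym (q^·-q^· b a f n)))

q^·-cong : ∀ k {f g} → f ≗ g → q^ k · f ≗ q^ k · g
q^·-cong zero    f≗g n       = f≗g n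
q^·-cong (suc k) f≗g zero    = refl
q^·-cong (suc k) f≗g (suc n) = q^·-cong k f≗g n

q^·-congᵇ : ∀ k {f g} n → (∀ {i} → i ≤ n → f i ≡ g i) → (q^ k · f) n ≡ (q^ k · g) n
q^·-congᵇ zero    n       f≡g = f≡g ℕₚ.≤-refl
q^·-congᵇ (suc k) zero    f≡g = refl
q^·-congᵇ (suc k) (suc n) f≡g = q^·-congᵇ k n (f≡g ∘ ℕₚ.m≤n⇒m≤1+n)

q^1+·-earlier : ∀ k {f g} n → (∀ {i} → i < n → f i ≡ g i) →
                (q^ suc k · f) n ≡ (q^ suc k · g) n
q^1+·-earlier k zero    f≡g = refl
q^1+·-earlier k (suc n) f≡g = q^·-congᵇ k n (f≡g ∘ s≤s)

q^·-0ˢ : ∀ k → q^ k · 0ˢ ≗ 0ˢ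
q^·-0ˢ zero    n       = refl
q^·-0ˢ (suc k) zero    = refl
q^·-0ˢ (suc k) (suc n) = q^·-0ˢ k n

q^·-+ˢ : ∀ k f g → q^ k · (f +ˢ g) ≗ q^ k · f +ˢ q^ k · g
q^·-+ˢ zero    f g n       = refl
q^·-+ˢ (suc k) f g zero    = refl
q^·-+ˢ (suc k) f g (suc n) = q^·-+ˢ k f g n

q^·-subS : ∀ k f g → q^ k · subS f g ≗ subS (q^ k · f) (q^ k · g)
q^·-subS zero    f g n       = refl
q^·-subS (suc k) f g zero    = refl
q^·-subS (suc k) f g (suc n) = q^·-subS k f g n

q^·-sumTo : ∀ k N (F : ℕ → Ser) n →
            (q^ k · (λ i → sumTo N (λ j → F j i))) n ≡ sumTo N (λ j → (q^ k · F j) n)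
q^·-sumTo zero    N F n       = refl
q^·-sumTo (suc k) N F zero    = sym (sumTo-zero N (λ _ _ → refl))
q^·-sumTo (suc k) N F (suc n) = q^·-sumTo k N F n

1-q^·-q^· : ∀ d e f → 1-q^ d · q^ e · f ≗ q^ e · 1-q^ d · f
1-q^·-q^· d e f n =
  trans (cong (λ x → (q^ e · f) n ℤ.- x) (q^·-comm d e f n)) (sym (q^·-subS e f (q^ d · f) n))

1-q^0· : ∀ f → 1-q^ 0 · f ≗ 0ˢ
1-q^0· f n = ℤₚ.+-inverseʳ (f n)

1-q^·-decompose : ∀ a b f n → (1-q^ (a + b + a) · f) n
                  ≡ ((1-q^ a · f) +ˢ q^ (a + b) · 1-q^ a · f +ˢ q^ a · 1-q^ b · f) n
1-q^·-decompose a b f n = begin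
  f₀ ℤ.- f₃
    ≡⟨ solve 4 (λ f₀ f₁ f₂ f₃ → f₀ :- f₃ := ((f₀ :- f₁) :+ (f₂ :- f₃)) :+ (f₁ :- f₂))
               refl f₀ f₁ f₂ f₃ ⟩
  ((f₀ ℤ.- f₁) ℤ.+ (f₂ ℤ.- f₃)) ℤ.+ (f₁ ℤ.- f₂)
    ≡⟨ cong₂ (λ x y → ((f₀ ℤ.- f₁) ℤ.+ x) ℤ.+ y) (sym middle) (sym last) ⟩
  ((1-q^ a · f) +ˢ q^ (a + b) · 1-q^ a · f +ˢ q^ a · 1-q^ b · f) n
    ∎
  where
    open ≡-Reasoning
    f₀ = f n
    f₁ = (q^ a · f) n
    f₂ = (q^ (a + b) · f) n
    f₃ = (q^ (a + b + a) · f) n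
    middle : (q^ (a + b) · 1-q^ a · f) n ≡ f₂ ℤ.- f₃
    middle = trans (q^·-subS (a + b) f (q^ a · f) n)
                   (cong (λ x → f₂ ℤ.- x) (q^·-q^· (a + b) a f n))
    last : (q^ a · 1-q^ b · f) n ≡ f₁ ℤ.- f₂
    last = trans (q^·-subS a f (q^ b · f) n) (cong (λ x → f₁ ℤ.- x) (q^·-q^· a b f n))

monoS≗q^·oneS : ∀ e → monoS e ≗ q^ e · oneS
monoS≗q^·oneS zero    zero    = refl
monoS≗q^·oneS zero    (suc n) = refl
monoS≗q^·oneS (suc e) zero    = refl
monoS≗q^·oneS (suc e) (suc n) = monoS≗q^·oneS e n

mulS-comm : ∀ f g → mulS f g ≗ mulS g f
mulS-comm f g n = begin
  sumTo n (λ k → f k ℤ.* g (n ∸ k))                  ≡⟨ sumTo-reverse n _ ⟩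
  sumTo n (λ k → f (n ∸ k) ℤ.* g (n ∸ (n ∸ k)))      ≡⟨ sumTo-cong n swap ⟩
  sumTo n (λ k → g k ℤ.* f (n ∸ k))                  ∎
  where
    open ≡-Reasoning
    swap : ∀ k → k ≤ n → f (n ∸ k) ℤ.* g (n ∸ (n ∸ k)) ≡ g k ℤ.* f (n ∸ k)
    swap k k≤n =
      trans (cong (λ i → f (n ∸ k) ℤ.* g i) (ℕₚ.m∸[m∸n]≡n k≤n)) (ℤₚ.*-comm (f (n ∸ k)) (g k))

mulS-congˡ : ∀ {f f′} g → f ≗ f′ → mulS f g ≗ mulS f′ g
mulS-congˡ g f≗f′ n = sumTo-cong n (λ k _ → cong (ℤ._* g (n ∸ k)) (f≗f′ k))

mulS-congʳ : ∀ f {g g′} → g ≗ g′ → mulS f g ≗ mulS f g′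
mulS-congʳ f g≗g′ n = sumTo-cong n (λ k _ → cong (f k ℤ.*_) (g≗g′ (n ∸ k)))

mulS-subSˡ : ∀ f g h → mulS (subS f g) h ≗ subS (mulS f h) (mulS g h)
mulS-subSˡ f g h n =
  trans (sumTo-cong n (λ k _ → distrib (f k) (g k) (h (n ∸ k))))
        (sumTo-- n (λ k → f k ℤ.* h (n ∸ k)) (λ k → g k ℤ.* h (n ∸ k)))
  where
    distrib : ∀ a b c → (a ℤ.- b) ℤ.* c ≡ a ℤ.* c ℤ.- b ℤ.* c
    distrib = solve 3 (λ a b c → (a :- b) :* c := a :* c :- b :* c) refl

mulS-zeroˡ : ∀ {f} g → f ≗ 0ˢ → mulS f g ≗ 0ˢ
mulS-zeroˡ g f≗0 n = sumTo-zero n (λ k _ → trans (cong (ℤ._* g (n ∸ k)) (f≗0 k)) (ℤₚ.*-zeroˡ (g (n ∸ k))))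

mulS-zeroʳ : ∀ f {g} → g ≗ 0ˢ → mulS f g ≗ 0ˢ
mulS-zeroʳ f g≗0 n = sumTo-zero n (λ k _ → trans (cong (f k ℤ.*_) (g≗0 (n ∸ k))) (ℤₚ.*-zeroʳ (f k)))

mulS-q^·ˡ : ∀ k f g → mulS (q^ k · f) g ≗ q^ k · mulS f g
mulS-q^·ˡ zero    f g n       = refl
mulS-q^·ˡ (suc k) f g zero    = ℤₚ.*-zeroˡ (g 0)
mulS-q^·ˡ (suc k) f g (suc n) = begin
  sumTo (suc n) (λ j → (q^ suc k · f) j ℤ.* g (suc n ∸ j))
    ≡⟨ sumTo-suc n _ ⟩
  0ℤ ℤ.* g (suc n) ℤ.+ mulS (q^ k · f) g n
    ≡⟨ cong (λ x → 0ℤ ℤ.* g (suc n) ℤ.+ x) (mulS-q^·ˡ k f g n) ⟩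
  0ℤ ℤ.* g (suc n) ℤ.+ (q^ k · mulS f g) n
    ≡⟨ cong (ℤ._+ (q^ k · mulS f g) n) (ℤₚ.*-zeroˡ (g (suc n))) ⟩
  0ℤ ℤ.+ (q^ k · mulS f g) n
    ≡⟨ ℤₚ.+-identityˡ _ ⟩
  (q^ k · mulS f g) n
    ∎
  where open ≡-Reasoning

mulS-identityˡ : ∀ f → mulS oneS f ≗ f
mulS-identityˡ f zero    = ℤₚ.*-identityˡ (f 0)
mulS-identityˡ f (suc n) = begin
  sumTo (suc n) (λ k → oneS k ℤ.* f (suc n ∸ k))
    ≡⟨ sumTo-suc n _ ⟩
  1ℤ ℤ.* f (suc n) ℤ.+ sumTo n (λ k → 0ℤ ℤ.* f (n ∸ k))
    ≡⟨ cong₂ ℤ._+_ (ℤₚ.*-identityˡ (f (suc n)))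
                   (sumTo-zero n (λ k _ → ℤₚ.*-zeroˡ (f (n ∸ k)))) ⟩
  f (suc n) ℤ.+ 0ℤ
    ≡⟨ ℤₚ.+-identityʳ _ ⟩
  f (suc n)
    ∎
  where open ≡-Reasoning

mulS-monoSˡ : ∀ e g → mulS (monoS e) g ≗ q^ e · g
mulS-monoSˡ e g n = trans (mulS-congˡ g (monoS≗q^·oneS e) n)
                          (trans (mulS-q^·ˡ e oneS g n) (q^·-cong e (mulS-identityˡ g) n))

mulS-1-q^·ˡ : ∀ d f g → 1-q^ d · mulS f g ≗ mulS (1-q^ d · f) g
mulS-1-q^·ˡ d f g n =
  trans (cong (λ x → mulS f g n ℤ.- x) (sym (mulS-q^·ˡ d f g n))) (sym (mulS-subSˡ f (q^ d · f) g n))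

mulS-1-q^·ʳ : ∀ d f g → 1-q^ d · mulS f g ≗ mulS f (1-q^ d · g)
mulS-1-q^·ʳ d f g n = begin
  (1-q^ d · mulS f g) n     ≡⟨ cong₂ ℤ._-_ (mulS-comm f g n) (q^·-cong d (mulS-comm f g) n) ⟩
  (1-q^ d · mulS g f) n     ≡⟨ mulS-1-q^·ˡ d g f n ⟩
  mulS (1-q^ d · g) f n     ≡⟨ mulS-comm (1-q^ d · g) f n ⟩
  mulS f (1-q^ d · g) n     ∎
  where open ≡-Reasoning

-- Reciprocals and q-Pochhammer symbols

lookupD-++-< : ∀ (l : List ℤ) x i → i < length l → lookupD (l ++ x ∷ []) i ≡ lookupD l i
lookupD-++-< (y ∷ l) x zero    _         = refl
lookupD-++-< (y ∷ l) x (suc i) (s≤s i<l) = lookupD-++-< l x i i<l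

lookupD-++-length : ∀ (l : List ℤ) x → lookupD (l ++ x ∷ []) (length l) ≡ x
lookupD-++-length []      x = refl
lookupD-++-length (y ∷ l) x = lookupD-++-length l x

length-invUpTo : ∀ f n → length (invUpTo f n) ≡ suc n
length-invUpTo f zero    = refl
length-invUpTo f (suc n) =
  trans (Listₚ.length-++ (invUpTo f n)) (trans (ℕₚ.+-comm _ 1) (cong suc (length-invUpTo f n)))

lookupD-invUpTo : ∀ f n i → i ≤ n → lookupD (invUpTo f n) i ≡ invS f i
lookupD-invUpTo f zero    zero i≤n = refl
lookupD-invUpTo f (suc n) i    i≤1+n with i ≟ suc n
... | yes refl = refl
... | no i≢1+n =
  trans (lookupD-++-< (invUpTo f n) _ i (subst (i <_) (sym (length-invUpTo f n)) (s≤s i≤n)))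
        (lookupD-invUpTo f n i i≤n)
  where i≤n = ℕₚ.≤-pred (ℕₚ.≤∧≢⇒< i≤1+n i≢1+n)

invS-suc : ∀ f n → invS f (suc n) ≡ - sumTo n (λ k → f (suc k) ℤ.* invS f (n ∸ k))
invS-suc f n = trans last (cong -_ (sumTo-cong n (λ k _ → cong (f (suc k) ℤ.*_) (earlier k))))
  where
    prev = invUpTo f n
    new  = - sumTo n (λ k → f (suc k) ℤ.* lookupD prev (n ∸ k))
    last : lookupD (prev ++ new ∷ []) (suc n) ≡ new
    last = subst (λ i → lookupD (prev ++ new ∷ []) i ≡ new) (length-invUpTo f n)
                 (lookupD-++-length prev new)
    earlier : ∀ k → lookupD prev (n ∸ k) ≡ invS f (n ∸ k)
    earlier k = lookupD-invUpTo f n (n ∸ k) (ℕₚ.m∸n≤m n k)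

mulS-invSʳ : ∀ f → f 0 ≡ 1ℤ → mulS f (invS f) ≗ oneS
mulS-invSʳ f f₀≡1 zero    = cong (ℤ._* 1ℤ) f₀≡1
mulS-invSʳ f f₀≡1 (suc n) = begin
  sumTo (suc n) (λ k → f k ℤ.* invS f (suc n ∸ k))
    ≡⟨ sumTo-suc n _ ⟩
  f 0 ℤ.* invS f (suc n) ℤ.+ rest
    ≡⟨ cong₂ (λ a b → a ℤ.* b ℤ.+ rest) f₀≡1 (invS-suc f n) ⟩
  1ℤ ℤ.* - rest ℤ.+ rest
    ≡⟨ solve 1 (λ x → con 1ℤ :* (:- x) :+ x := con 0ℤ) refl rest ⟩
  0ℤ
    ∎
  where
    open ≡-Reasoning
    rest = sumTo n (λ k → f (suc k) ℤ.* invS f (n ∸ k))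

invS-unique : ∀ f g → f 0 ≡ 1ℤ → mulS f g ≗ oneS → g ≗ invS f
invS-unique f g f₀≡1 fg≗1 = ≗-by-strong-induction step
  where
    f₀*≡ : ∀ x → f 0 ℤ.* x ≡ x
    f₀*≡ x = trans (cong (ℤ._* x) f₀≡1) (ℤₚ.*-identityˡ x)
    step : ∀ n → (∀ {i} → i < n → g i ≡ invS f i) → g n ≡ invS f n
    step zero    _  = trans (sym (f₀*≡ (g 0))) (fg≗1 0)
    step (suc n) ih = begin
      g (suc n)
        ≡⟨ inverseˡ-unique (g (suc n)) rest g[1+n]+rest≡0 ⟩
      - rest
        ≡⟨ cong -_ (sumTo-cong n (λ k _ → cong (f (suc k) ℤ.*_) (ih (s≤s (ℕₚ.m∸n≤m n k))))) ⟩
      - sumTo n (λ k → f (suc k) ℤ.* invS f (n ∸ k))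
        ≡⟨ sym (invS-suc f n) ⟩
      invS f (suc n)
        ∎
      where
        open ≡-Reasoning
        rest = sumTo n (λ k → f (suc k) ℤ.* g (n ∸ k))
        g[1+n]+rest≡0 : g (suc n) ℤ.+ rest ≡ 0ℤ
        g[1+n]+rest≡0 = trans (cong (ℤ._+ rest) (sym (f₀*≡ (g (suc n)))))
                              (trans (sym (sumTo-suc n (λ k → f k ℤ.* g (suc n ∸ k)))) (fg≗1 (suc n)))

poch-const : ∀ b a k → poch (suc b) a k 0 ≡ 1ℤ
poch-const b a zero    = refl
poch-const b a (suc k) = cong (ℤ._* 1ℤ) (poch-const b a k)

poch-suc : ∀ b a k → poch b a (suc k) ≗ 1-q^ (b + a * k) · poch b a k
poch-suc b a k n = begin
  mulS P (subS oneS (monoS e)) n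
    ≡⟨ mulS-comm P (subS oneS (monoS e)) n ⟩
  mulS (subS oneS (monoS e)) P n
    ≡⟨ mulS-subSˡ oneS (monoS e) P n ⟩
  mulS oneS P n ℤ.- mulS (monoS e) P n
    ≡⟨ cong₂ ℤ._-_ (mulS-identityˡ P n) (mulS-monoSˡ e P n) ⟩
  (1-q^ e · P) n
    ∎
  where
    open ≡-Reasoning
    P = poch b a k
    e = b + a * k

invS-poch-suc : ∀ b a k →
                1-q^ (suc b + a * k) · invS (poch (suc b) a (suc k)) ≗ invS (poch (suc b) a k)
invS-poch-suc b a k = invS-unique P (1-q^ e · P′⁻¹) (poch-const b a k) inverse
  where
    P = poch (suc b) a k
    e = suc b + a * k
    P′⁻¹ = invS (poch (suc b) a (suc k))
    inverse : mulS P (1-q^ e · P′⁻¹) ≗ oneS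
    inverse n = begin
      mulS P (1-q^ e · P′⁻¹) n
        ≡⟨ sym (mulS-1-q^·ʳ e P P′⁻¹ n) ⟩
      (1-q^ e · mulS P P′⁻¹) n
        ≡⟨ mulS-1-q^·ˡ e P P′⁻¹ n ⟩
      mulS (1-q^ e · P) P′⁻¹ n
        ≡⟨ sym (mulS-congˡ P′⁻¹ (poch-suc (suc b) a k) n) ⟩
      mulS (poch (suc b) a (suc k)) P′⁻¹ n
        ≡⟨ mulS-invSʳ (poch (suc b) a (suc k)) (poch-const b a (suc k)) n ⟩
      oneS n
        ∎
      where open ≡-Reasoning

invS-poch-zero : ∀ b a → invS (poch b a 0) ≗ oneS
invS-poch-zero b a n = sym (invS-unique oneS oneS refl (mulS-identityˡ oneS) n)

1-q^·-exponent : ∀ {a b} f → a ≡ b → 1-q^ a · f ≗ 1-q^ b · f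
1-q^·-exponent f refl n = refl

1-q^·-q^·-step : ∀ d {e e′ δ} {f f′} → e′ ≡ δ + e → 1-q^ d · f′ ≗ f →
                 1-q^ d · q^ e′ · f′ ≗ q^ δ · q^ e · f
1-q^·-q^·-step d {e} {e′} {δ} {f} {f′} e′≡δ+e step n = begin
  (1-q^ d · q^ e′ · f′) n    ≡⟨ 1-q^·-q^· d e′ f′ n ⟩
  (q^ e′ · 1-q^ d · f′) n    ≡⟨ q^·-cong e′ step n ⟩
  (q^ e′ · f) n              ≡⟨ q^·-exponent f e′≡δ+e n ⟩
  (q^ (δ + e) · f) n         ≡⟨ sym (q^·-q^· δ e f n) ⟩
  (q^ δ · q^ e · f) n        ∎
  where open ≡-Reasoning

pentagonal : ℕ → ℕ
pentagonal n = (3 * n * n + n) ℕ./ 2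

pentagonal-suc : ∀ j → pentagonal (suc j) ≡ pentagonal j + (3 * j + 2)
pentagonal-suc j = trans (cong (ℕ._/ 2) (double-step j)) (half-+ (3 * j * j + j) (3 * j + 2))
  where
    double-step : ∀ j → 3 * suc j * suc j + suc j ≡ 3 * j * j + j + (3 * j + 2) * 2
    double-step = solve-∀
    half-+ : ∀ x y → (x + y * 2) ℕ./ 2 ≡ x ℕ./ 2 + y
    half-+ x y = trans (+-distrib-/-∣ʳ x (divides y refl)) (cong (λ z → x ℕ./ 2 + z) (m*n/n≡m y 2))

qExp : ℕ → ℕ → ℕ
qExp n₁ n₂ = 4 * n₂ * n₂ + 2 * n₂ + pentagonal n₁ + 4 * n₂ * n₁

qExp-suc₁ : ∀ j k → qExp (suc j) k ≡ (3 * j + 2 + 4 * k) + qExp j k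
qExp-suc₁ j k = trans (cong (λ p → 4 * k * k + 2 * k + p + 4 * k * suc j) (pentagonal-suc j))
                      (regroup (pentagonal j) j k)
  where
    regroup : ∀ p j k → 4 * k * k + 2 * k + (p + (3 * j + 2)) + 4 * k * suc j
                        ≡ (3 * j + 2 + 4 * k) + (4 * k * k + 2 * k + p + 4 * k * j)
    regroup = solve-∀

qExp-suc₂ : ∀ a j → qExp a (suc j) ≡ (8 * j + 6 + 4 * a) + qExp a j
qExp-suc₂ a j = regroup (pentagonal a) a j
  where
    regroup : ∀ p a j → 4 * suc j * suc j + 2 * suc j + p + 4 * suc j * a
                        ≡ (8 * j + 6 + 4 * a) + (4 * j * j + 2 * j + p + 4 * j * a)
    regroup = solve-∀

invDen : ℕ → ℕ → Ser
invDen n₁ n₂ = mulS (invS (poch 1 1 n₁)) (invS (poch 4 4 n₂))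

summand : ℕ → ℕ → Ser
summand n₁ n₂ = q^ qExp n₁ n₂ · invDen n₁ n₂

summand-step₁ : ∀ j k → 1-q^ (suc j) · summand (suc j) k ≗ q^ (3 * j + 2 + 4 * k) · summand j k
summand-step₁ j k = 1-q^·-q^·-step (suc j) {δ = 3 * j + 2 + 4 * k} (qExp-suc₁ j k) λ n → begin
  (1-q^ suc j · mulS I₁′ I₄) n
    ≡⟨ mulS-1-q^·ˡ (suc j) I₁′ I₄ n ⟩
  mulS (1-q^ suc j · I₁′) I₄ n
    ≡⟨ mulS-congˡ I₄ (λ i → trans (1-q^·-exponent I₁′ (cong suc (sym (ℕₚ.*-identityˡ j))) i)
                                  (invS-poch-suc 0 1 j i)) n ⟩
  invDen j k n
    ∎
  where
    open ≡-Reasoning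
    I₁′ = invS (poch 1 1 (suc j))
    I₄  = invS (poch 4 4 k)

summand-step₂ : ∀ a j → 1-q^ (4 + 4 * j) · summand a (suc j) ≗ q^ (8 * j + 6 + 4 * a) · summand a j
summand-step₂ a j = 1-q^·-q^·-step (4 + 4 * j) {δ = 8 * j + 6 + 4 * a} (qExp-suc₂ a j) λ n → begin
  (1-q^ (4 + 4 * j) · mulS I₁ I₄′) n    ≡⟨ mulS-1-q^·ʳ (4 + 4 * j) I₁ I₄′ n ⟩
  mulS I₁ (1-q^ (4 + 4 * j) · I₄′) n    ≡⟨ mulS-congʳ I₁ (invS-poch-suc 3 4 j) n ⟩
  invDen a j n
    ∎
  where
    open ≡-Reasoning
    I₁  = invS (poch 1 1 a)
    I₄′ = invS (poch 4 4 (suc j))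

-- Power series in x

infixr 8 x^_·_

x^_·_ : ℕ → Ser2 → Ser2
x^ zero · F              = F
(x^ suc t · F) zero    = 0ˢ
(x^ suc t · F) (suc m) = (x^ t · F) m

x^·-at : ∀ t d F → (x^ t · F) (t + d) ≡ F d
x^·-at zero    d F = refl
x^·-at (suc t) d F = x^·-at t d F

x^·-below : ∀ t F m → m < t → (x^ t · F) m ≡ 0ˢ
x^·-below (suc t) F zero    _         = refl
x^·-below (suc t) F (suc m) (s≤s m<t) = x^·-below t F m m<t

x^·-above : ∀ t F m → t ≤ m → (x^ t · F) m ≡ F (m ∸ t)
x^·-above zero    F m       _         = refl
x^·-above (suc t) F (suc m) (s≤s t≤m) = x^·-above t F m t≤m

x^·-cong : ∀ t m {F G : Ser2} → (∀ r → r ≤ m → F r ≗ G r) → (x^ t · F) m ≗ (x^ t · G) m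
x^·-cong zero    m       F≗G = F≗G m ℕₚ.≤-refl
x^·-cong (suc t) zero    F≗G = λ _ → refl
x^·-cong (suc t) (suc m) F≗G = x^·-cong t m (λ r r≤m → F≗G r (ℕₚ.m≤n⇒m≤1+n r≤m))

x^·-x^· : ∀ a b F m → (x^ a · x^ b · F) m ≡ (x^ (a + b) · F) m
x^·-x^· zero    b F m       = refl
x^·-x^· (suc a) b F zero    = refl
x^·-x^· (suc a) b F (suc m) = x^·-x^· a b F m

x^·-x^1-suc : ∀ t F m → (x^ t · x^ 1 · F) (suc m) ≡ (x^ t · F) m
x^·-x^1-suc t F m = trans (x^·-x^· t 1 F (suc m)) (cong (λ e → (x^ e · F) (suc m)) (ℕₚ.+-comm t 1))

x^·-add2 : ∀ t F G m → (x^ t · add2 F G) m ≗ (x^ t · F) m +ˢ (x^ t · G) m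
x^·-add2 zero    F G m       n = refl
x^·-add2 (suc t) F G zero    n = refl
x^·-add2 (suc t) F G (suc m) n = x^·-add2 t F G m n

x^·-sumTo : ∀ t N (F : ℕ → Ser2) m n →
            sumTo N (λ j → (x^ t · F j) m n) ≡ (x^ t · (λ r i → sumTo N (λ j → F j r i))) m n
x^·-sumTo zero    N F m       n = refl
x^·-sumTo (suc t) N F zero    n = sumTo-zero N (λ _ _ → refl)
x^·-sumTo (suc t) N F (suc m) n = x^·-sumTo t N F m n

x^·-natural : (G : ℕ → Ser → Ser) → (∀ m → G m 0ˢ ≗ 0ˢ) →
              ∀ t F m → (x^ t · (λ r → G (t + r) (F r))) m ≗ G m ((x^ t · F) m)
x^·-natural G G0 zero    F m       n = refl
x^·-natural G G0 (suc t) F zero    n = sym (G0 0 n)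
x^·-natural G G0 (suc t) F (suc m) n = x^·-natural (G ∘ suc) (G0 ∘ suc) t F m n

≡ᵇ-refl : ∀ i → (i ≡ᵇ i) ≡ true
≡ᵇ-refl zero    = refl
≡ᵇ-refl (suc i) = ≡ᵇ-refl i

mono2-diagonal : ∀ i j → mono2 i j i ≗ monoS j
mono2-diagonal i j n rewrite ≡ᵇ-refl i = refl

mono2-offDiagonal : ∀ i j i′ → i′ ≢ i → mono2 i j i′ ≗ 0ˢ
mono2-offDiagonal i j i′ i′≢i n with i′ ≡ᵇ i in eq
... | false = refl
... | true  = ⊥-elim (i′≢i (ℕₚ.≡ᵇ⇒≡ i′ i (subst T (sym eq) tt)))

mul2-mono2 : ∀ i j G m → mul2 (mono2 i j) G m ≗ (x^ i · (λ d → q^ j · G d)) m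
mul2-mono2 i j G m n with i ≤? m
... | no i≰m =
  trans (sumTo-zero m (λ i′ i′≤m → mulS-zeroˡ (G (m ∸ i′))
                                    (mono2-offDiagonal i j i′ (λ { refl → i≰m i′≤m })) n))
        (cong (λ F → F n) (sym (x^·-below i _ m (ℕₚ.≰⇒> i≰m))))
... | yes i≤m = begin
  mul2 (mono2 i j) G m n
    ≡⟨ sumTo-single m i i≤m (λ i′ _ i′≢i → mulS-zeroˡ (G (m ∸ i′)) (mono2-offDiagonal i j i′ i′≢i) n) ⟩
  mulS (mono2 i j i) (G (m ∸ i)) n
    ≡⟨ mulS-congˡ (G (m ∸ i)) (mono2-diagonal i j) n ⟩
  mulS (monoS j) (G (m ∸ i)) n
    ≡⟨ mulS-monoSˡ j (G (m ∸ i)) n ⟩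
  (q^ j · G (m ∸ i)) n
    ≡⟨ cong (λ F → F n) (sym (x^·-above i _ m i≤m)) ⟩
  (x^ i · (λ d → q^ j · G d)) m n
    ∎
  where open ≡-Reasoning

liftQ-vanishes : ∀ S m i → i < m → liftQ S (m ∸ i) ≗ 0ˢ
liftQ-vanishes S (suc m) zero    _         n = refl
liftQ-vanishes S (suc m) (suc i) (s≤s i<m) n = liftQ-vanishes S m i i<m n

mul2-liftQ : ∀ F S m → mul2 F (liftQ S) m ≗ mulS (F m) S
mul2-liftQ F S m n = begin
  mul2 F (liftQ S) m n
    ≡⟨ sumTo-single m m ℕₚ.≤-refl (λ i i≤m i≢m →
         mulS-zeroʳ (F i) (liftQ-vanishes S m i (ℕₚ.≤∧≢⇒< i≤m i≢m)) n) ⟩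
  mulS (F m) (liftQ S (m ∸ m)) n
    ≡⟨ cong (λ i → mulS (F m) (liftQ S i) n) (ℕₚ.n∸n≡0 m) ⟩
  mulS (F m) S n
    ∎
  where open ≡-Reasoning

1+xq^_·_ : ℕ → Ser → Ser2
(1+xq^ K · S) zero          = S
(1+xq^ K · S) (suc zero)    = q^ K · S
(1+xq^ K · S) (suc (suc _)) = 0ˢ

mul2-1+xq^ : ∀ K S m → mul2 (add2 one2 (mono2 1 K)) (liftQ S) m ≗ (1+xq^ K · S) m
mul2-1+xq^ K S m n = trans (mul2-liftQ (add2 one2 (mono2 1 K)) S m n) (coefficient m)
  where
    coefficient : ∀ m → mulS (add2 one2 (mono2 1 K) m) S n ≡ (1+xq^ K · S) m n
    coefficient zero          = trans (mulS-congˡ S (ℤₚ.+-identityʳ ∘ oneS) n) (mulS-identityˡ S n)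
    coefficient (suc zero)    = trans (mulS-congˡ S (ℤₚ.+-identityˡ ∘ monoS K) n) (mulS-monoSˡ K S n)
    coefficient (suc (suc m)) = mulS-zeroˡ S (λ _ → refl) n

summandˣ : ℕ → ℕ → Ser2
summandˣ n₁ n₂ d = q^ qExp n₁ n₂ · (1+xq^ (4 * n₂ + 2 * n₁ + 1) · invDen n₁ n₂) d

term≗x^·summandˣ : ∀ n₁ n₂ m → term n₁ n₂ m ≗ (x^ (2 * n₂ + n₁) · summandˣ n₁ n₂) m
term≗x^·summandˣ n₁ n₂ m n =
  trans (mul2-mono2 (2 * n₂ + n₁) (qExp n₁ n₂) _ m n)
        (x^·-cong (2 * n₂ + n₁) m (λ r _ → q^·-cong (qExp n₁ n₂) (mul2-1+xq^ _ (invDen n₁ n₂) r)) n)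

sumTo-x^·-linear : ∀ (F : ℕ → Ser2) → (∀ a d → F a (suc (suc d)) ≗ 0ˢ) → ∀ m r → r ≤ m → ∀ n →
                   sumTo m (λ a → (x^ a · F a) r n) ≡ add2 (λ a → F a 0) (x^ 1 · (λ a → F a 1)) r n
sumTo-x^·-linear F F₂₊≗0 m r r≤m n = begin
  sumTo m (λ a → (x^ a · F a) r n)
    ≡⟨ cong (λ N → sumTo N (λ a → (x^ a · F a) r n)) (sym (ℕₚ.m∸n+n≡m r≤m)) ⟩
  sumTo (m ∸ r + r) (λ a → (x^ a · F a) r n)
    ≡⟨ sumTo-extend (m ∸ r) r _ (λ a r<a _ → cong (λ f → f n) (x^·-below a (F a) r r<a)) ⟩
  sumTo r (λ a → (x^ a · F a) r n)
    ≡⟨ sumTo-cong r (λ a a≤r → cong (λ f → f n) (x^·-above a (F a) r a≤r)) ⟩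
  sumTo r (λ a → F a (r ∸ a) n)
    ≡⟨ sumTo-reverse r _ ⟩
  sumTo r (λ d → F (r ∸ d) (r ∸ (r ∸ d)) n)
    ≡⟨ sumTo-cong r (λ d d≤r → cong (λ e → F (r ∸ d) e n) (ℕₚ.m∸[m∸n]≡n d≤r)) ⟩
  sumTo r (λ d → F (r ∸ d) d n)
    ≡⟨ lowest r ⟩
  add2 (λ a → F a 0) (x^ 1 · (λ a → F a 1)) r n
    ∎
  where
    open ≡-Reasoning
    lowest : ∀ r → sumTo r (λ d → F (r ∸ d) d n) ≡ add2 (λ a → F a 0) (x^ 1 · (λ a → F a 1)) r n
    lowest zero    = sym (ℤₚ.+-identityʳ _)
    lowest (suc r) = trans (sumTo-suc r _) (cong (λ x → F (suc r) 0 n ℤ.+ x)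
      (sumTo-single r 0 z≤n λ { (suc d) _ _ → F₂₊≗0 (r ∸ suc d) d n
                              ; zero    _ 0≢0 → ⊥-elim (0≢0 refl) }))

oddSummand : ℕ → Ser2
oddSummand k a = q^ (2 * (2 * k + a) + 1) · summand a k

row : ℕ → Ser2
row k = add2 (λ a → summand a k) (x^ 1 · oddSummand k)

sumTo-x^·-summandˣ : ∀ k m r → r ≤ m → ∀ n → sumTo m (λ a → (x^ a · summandˣ a k) r n) ≡ row k r n
sumTo-x^·-summandˣ k m r r≤m n =
  trans (sumTo-x^·-linear (λ a → summandˣ a k) (λ a d → q^·-0ˢ (qExp a k)) m r r≤m n)
        (cong (λ x → summand r k n ℤ.+ x) (x^·-cong 1 r (λ a _ i → linear-coefficient a i) n))
  where
    linear-coefficient : ∀ a → summandˣ a k 1 ≗ oddSummand k a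
    linear-coefficient a i =
      trans (q^·-comm (qExp a k) (4 * k + 2 * a + 1) (invDen a k) i)
            (q^·-exponent (summand a k) (exponent k a) i)
      where
        exponent : ∀ k a → 4 * k + 2 * a + 1 ≡ 2 * (2 * k + a) + 1
        exponent = solve-∀

-- slice k m is the sum of the terms of the right-hand side with n₂ = k and 2 n₂ + n₁ = m, without
-- the factor (1 + x q^(4n₂+2n₁+1)).
slice : ℕ → Ser2
slice k = x^ (2 * k) · (λ a → summand a k)

bSer : Ser2
bSer m n = sumTo m (λ k → slice k m n)

-- F(x) + x q F(x q²) for F(x) = Σ F m x^m.
plusXqDilated : Ser2 → Ser2
plusXqDilated F m = F m +ˢ (x^ 1 · (λ p → q^ (2 * p + 1) · F p)) m

plusXqDilated-cong : ∀ {F G} → (∀ m → F m ≗ G m) → ∀ m → plusXqDilated F m ≗ plusXqDilated G m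
plusXqDilated-cong F≗G m n =
  cong₂ ℤ._+_ (F≗G m n) (x^·-cong 1 m (λ p _ → q^·-cong (2 * p + 1) (F≗G p)) n)

n<2*[1+n] : ∀ p → p < 2 * suc p
n<2*[1+n] p = s≤s (ℕₚ.m≤m+n p (suc p + 0))

rhsCoeff-decompose : ∀ m → rhsCoeff m ≗ plusXqDilated bSer m
rhsCoeff-decompose m n = begin
  rhsCoeff m n
    ≡⟨ sumTo-comm m m (λ n₁ n₂ → term n₁ n₂ m n) ⟩
  sumTo m (λ k → sumTo m (λ n₁ → term n₁ k m n))
    ≡⟨ sumTo-cong m (λ k _ → column k) ⟩
  sumTo m (λ k → (x^ (2 * k) · row k) m n)
    ≡⟨ sumTo-cong m (λ k _ → x^·-add2 (2 * k) _ _ m n) ⟩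
  sumTo m (λ k → slice k m n ℤ.+ (x^ (2 * k) · x^ 1 · oddSummand k) m n)
    ≡⟨ sumTo-+ m _ _ ⟩
  bSer m n ℤ.+ sumTo m (λ k → (x^ (2 * k) · x^ 1 · oddSummand k) m n)
    ≡⟨ cong (λ x → bSer m n ℤ.+ x) (dilated m) ⟩
  plusXqDilated bSer m n
    ∎
  where
    open ≡-Reasoning
    column : ∀ k → sumTo m (λ n₁ → term n₁ k m n) ≡ (x^ (2 * k) · row k) m n
    column k = begin
      sumTo m (λ n₁ → term n₁ k m n)
        ≡⟨ sumTo-cong m (λ n₁ _ → trans (term≗x^·summandˣ n₁ k m n)
                                         (cong (λ F → F n) (sym (x^·-x^· (2 * k) n₁ (summandˣ n₁ k) m)))) ⟩
      sumTo m (λ n₁ → (x^ (2 * k) · x^ n₁ · summandˣ n₁ k) m n)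
        ≡⟨ x^·-sumTo (2 * k) m (λ n₁ → x^ n₁ · summandˣ n₁ k) m n ⟩
      (x^ (2 * k) · (λ r i → sumTo m (λ n₁ → (x^ n₁ · summandˣ n₁ k) r i))) m n
        ≡⟨ x^·-cong (2 * k) m (λ r r≤m → sumTo-x^·-summandˣ k m r r≤m) n ⟩
      (x^ (2 * k) · row k) m n
        ∎
    dilated : ∀ m → sumTo m (λ k → (x^ (2 * k) · x^ 1 · oddSummand k) m n)
                    ≡ (x^ 1 · (λ p → q^ (2 * p + 1) · bSer p)) m n
    dilated zero    = refl
    dilated (suc p) = begin
      sumTo (suc p) (λ k → (x^ (2 * k) · x^ 1 · oddSummand k) (suc p) n)
        ≡⟨ sumTo-cong (suc p) (λ k _ → cong (λ F → F n) (x^·-x^1-suc (2 * k) (oddSummand k) p)) ⟩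
      sumTo (suc p) (λ k → (x^ (2 * k) · oddSummand k) p n)
        ≡⟨ sumTo-dropLast p _ (cong (λ F → F n) (x^·-below (2 * suc p) (oddSummand (suc p)) p (n<2*[1+n] p))) ⟩
      sumTo p (λ k → (x^ (2 * k) · oddSummand k) p n)
        ≡⟨ sumTo-cong p (λ k _ → x^·-natural (λ r → q^ (2 * r + 1) ·_) (λ r → q^·-0ˢ (2 * r + 1))
                                             (2 * k) (λ a → summand a k) p n) ⟩
      sumTo p (λ k → (q^ (2 * p + 1) · slice k p) n)
        ≡⟨ sym (q^·-sumTo (2 * p + 1) p (λ k → slice k p) n) ⟩
      (q^ (2 * p + 1) · bSer p) n
        ∎

1-q^·-0ˢ : ∀ d → 1-q^ d · 0ˢ ≗ 0ˢ
1-q^·-0ˢ d n = cong (λ x → 0ℤ ℤ.- x) (q^·-0ˢ d n)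

1-q^·-sumTo : ∀ d N (F : ℕ → Ser) n →
              (1-q^ d · (λ i → sumTo N (λ j → F j i))) n ≡ sumTo N (λ j → (1-q^ d · F j) n)
1-q^·-sumTo d N F n =
  trans (cong (λ x → sumTo N (λ j → F j n) ℤ.- x) (q^·-sumTo d N F n)) (sym (sumTo-- N _ _))

-- With a = n₁ and m = 2k + a: 1 - q^(2m) = (1 - q^a) + q^(a+4k) (1 - q^a) + q^a (1 - q^(4k)), where
-- summand-step₁ absorbs the first two factors and summand-step₂ the last one.
leadTerm middleTerm edgeTerm : ℕ → Ser2
leadTerm   k j = q^ (2 * (2 * k + suc j) + j) · summand j k
middleTerm k j = q^ (4 * (2 * k + j) + 3) · summand j k
edgeTerm   k a = q^ a · 1-q^ (4 * k) · summand a k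

summand-split : ∀ k a → 1-q^ (2 * (2 * k + a)) · summand a k
                         ≗ (x^ 1 · leadTerm k) a +ˢ (x^ 1 · middleTerm k) a +ˢ edgeTerm k a
summand-split k zero n =
  trans (1-q^·-exponent (summand 0 k) (exponent k) n) (sym (ℤₚ.+-identityˡ _))
  where
    exponent : ∀ k → 2 * (2 * k + 0) ≡ 4 * k
    exponent = solve-∀
summand-split k (suc j) n = begin
  (1-q^ (2 * (2 * k + suc j)) · C′) n
    ≡⟨ 1-q^·-exponent C′ (exponent₀ k j) n ⟩
  (1-q^ (suc j + 4 * k + suc j) · C′) n
    ≡⟨ 1-q^·-decompose (suc j) (4 * k) C′ n ⟩
  ((1-q^ suc j · C′) +ˢ q^ (suc j + 4 * k) · 1-q^ suc j · C′ +ˢ q^ suc j · 1-q^ (4 * k) · C′) n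
    ≡⟨ cong₂ (λ x y → x ℤ.+ y ℤ.+ edgeTerm k (suc j) n) lead middle ⟩
  ((x^ 1 · leadTerm k) (suc j) +ˢ (x^ 1 · middleTerm k) (suc j) +ˢ edgeTerm k (suc j)) n
    ∎
  where
    open ≡-Reasoning
    C′ = summand (suc j) k
    exponent₀ : ∀ k j → 2 * (2 * k + suc j) ≡ suc j + 4 * k + suc j
    exponent₀ = solve-∀
    exponent₁ : ∀ k j → 3 * j + 2 + 4 * k ≡ 2 * (2 * k + suc j) + j
    exponent₁ = solve-∀
    exponent₂ : ∀ k j → suc j + 4 * k + (3 * j + 2 + 4 * k) ≡ 4 * (2 * k + j) + 3
    exponent₂ = solve-∀
    lead : (1-q^ suc j · C′) n ≡ leadTerm k j n
    lead = trans (summand-step₁ j k n) (q^·-exponent (summand j k) (exponent₁ k j) n)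
    middle : (q^ (suc j + 4 * k) · 1-q^ suc j · C′) n ≡ middleTerm k j n
    middle = trans (q^·-cong (suc j + 4 * k) (summand-step₁ j k) n)
                   (trans (q^·-q^· (suc j + 4 * k) _ (summand j k) n)
                          (q^·-exponent (summand j k) (exponent₂ k j) n))

summand-carry : ∀ k a → q^ (2 * suc (2 * k + a)) · summand a k
                         ≗ leadTerm k a +ˢ (x^ 1 · edgeTerm (suc k)) a
summand-carry k zero n =
  trans (q^·-exponent (summand 0 k) (exponent k) n) (sym (ℤₚ.+-identityʳ _))
  where
    exponent : ∀ k → 2 * suc (2 * k + 0) ≡ 2 * (2 * k + 1) + 0
    exponent = solve-∀
summand-carry k (suc j) n = begin
  (q^ e · C′) n
    ≡⟨ q^·-cong e (λ i → solve 2 (λ x y → x := y :+ (x :- y)) refl (C′ i) ((q^ suc j · C′) i)) n ⟩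
  (q^ e · (q^ suc j · C′ +ˢ 1-q^ suc j · C′)) n
    ≡⟨ q^·-+ˢ e _ _ n ⟩
  (q^ e · q^ suc j · C′) n ℤ.+ (q^ e · 1-q^ suc j · C′) n
    ≡⟨ cong₂ ℤ._+_ lead edge ⟩
  leadTerm k (suc j) n ℤ.+ edgeTerm (suc k) j n
    ∎
  where
    open ≡-Reasoning
    e  = 2 * suc (2 * k + suc j)
    C′ = summand (suc j) k
    exponent₁ : ∀ k j → 2 * suc (2 * k + suc j) + suc j ≡ 2 * (2 * k + suc (suc j)) + suc j
    exponent₁ = solve-∀
    exponent₂ : ∀ k j → 2 * suc (2 * k + suc j) + (3 * j + 2 + 4 * k) ≡ j + (8 * k + 6 + 4 * j)
    exponent₂ = solve-∀
    lead : (q^ e · q^ suc j · C′) n ≡ leadTerm k (suc j) n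
    lead = trans (q^·-q^· e (suc j) C′ n) (q^·-exponent C′ (exponent₁ k j) n)
    edge : (q^ e · 1-q^ suc j · C′) n ≡ edgeTerm (suc k) j n
    edge = begin
      (q^ e · 1-q^ suc j · C′) n
        ≡⟨ q^·-cong e (summand-step₁ j k) n ⟩
      (q^ e · q^ (3 * j + 2 + 4 * k) · summand j k) n
        ≡⟨ q^·-q^· e _ (summand j k) n ⟩
      (q^ (e + (3 * j + 2 + 4 * k)) · summand j k) n
        ≡⟨ q^·-exponent (summand j k) (exponent₂ k j) n ⟩
      (q^ (j + (8 * k + 6 + 4 * j)) · summand j k) n
        ≡⟨ sym (q^·-q^· j _ (summand j k) n) ⟩
      (q^ j · q^ (8 * k + 6 + 4 * j) · summand j k) n
        ≡⟨ sym (q^·-cong j (λ i → trans (1-q^·-exponent (summand j (suc k)) (ℕₚ.*-suc 4 k) i)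
                                        (summand-step₂ j k i)) n) ⟩
      edgeTerm (suc k) j n
        ∎

slice-step : ∀ k p → 1-q^ (2 * suc p) · slice k (suc p)
                     ≗ (x^ (2 * k) · leadTerm k) p +ˢ q^ (4 * p + 3) · slice k p
                       +ˢ (x^ (2 * k) · edgeTerm k) (suc p)
slice-step k p n = begin
  (1-q^ (2 * suc p) · slice k (suc p)) n
    ≡⟨ sym (x^·-natural (λ r → 1-q^ (2 * r) ·_) (λ r → 1-q^·-0ˢ (2 * r)) (2 * k) C (suc p) n) ⟩
  (x^ (2 * k) · (λ a → 1-q^ (2 * (2 * k + a)) · C a)) (suc p) n
    ≡⟨ x^·-cong (2 * k) (suc p) (λ a _ → summand-split k a) n ⟩
  (x^ (2 * k) · add2 (add2 (x^ 1 · leadTerm k) (x^ 1 · middleTerm k)) (edgeTerm k)) (suc p) n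
    ≡⟨ trans (x^·-add2 (2 * k) _ _ (suc p) n) (cong (ℤ._+ edge) (x^·-add2 (2 * k) _ _ (suc p) n)) ⟩
  (x^ (2 * k) · x^ 1 · leadTerm k) (suc p) n ℤ.+ (x^ (2 * k) · x^ 1 · middleTerm k) (suc p) n
    ℤ.+ edge
    ≡⟨ cong₂ (λ x y → x ℤ.+ y ℤ.+ edge) (cong (λ F → F n) (x^·-x^1-suc (2 * k) (leadTerm k) p))
                                        (cong (λ F → F n) (x^·-x^1-suc (2 * k) (middleTerm k) p)) ⟩
  (x^ (2 * k) · leadTerm k) p n ℤ.+ (x^ (2 * k) · middleTerm k) p n ℤ.+ edge
    ≡⟨ cong (λ x → (x^ (2 * k) · leadTerm k) p n ℤ.+ x ℤ.+ edge)
            (x^·-natural (λ r → q^ (4 * r + 3) ·_) (λ r → q^·-0ˢ (4 * r + 3)) (2 * k) C p n) ⟩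
  ((x^ (2 * k) · leadTerm k) p +ˢ q^ (4 * p + 3) · slice k p +ˢ (x^ (2 * k) · edgeTerm k) (suc p)) n
    ∎
  where
    open ≡-Reasoning
    C = λ a → summand a k
    edge = (x^ (2 * k) · edgeTerm k) (suc p) n

slice-carry : ∀ k p → (x^ (2 * k) · leadTerm k) p +ˢ (x^ (2 * suc k) · edgeTerm (suc k)) (suc p)
                      ≗ q^ (2 * suc p) · slice k p
slice-carry k p n = begin
  (x^ (2 * k) · leadTerm k) p n ℤ.+ (x^ (2 * suc k) · edgeTerm (suc k)) (suc p) n
    ≡⟨ cong (λ x → (x^ (2 * k) · leadTerm k) p n ℤ.+ x) edge-shift ⟩
  (x^ (2 * k) · leadTerm k) p n ℤ.+ (x^ (2 * k) · x^ 1 · edgeTerm (suc k)) p n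
    ≡⟨ sym (x^·-add2 (2 * k) (leadTerm k) (x^ 1 · edgeTerm (suc k)) p n) ⟩
  (x^ (2 * k) · add2 (leadTerm k) (x^ 1 · edgeTerm (suc k))) p n
    ≡⟨ sym (x^·-cong (2 * k) p (λ a _ → summand-carry k a) n) ⟩
  (x^ (2 * k) · (λ a → q^ (2 * suc (2 * k + a)) · summand a k)) p n
    ≡⟨ x^·-natural (λ r → q^ (2 * suc r) ·_) (λ r → q^·-0ˢ (2 * suc r)) (2 * k) (λ a → summand a k) p n ⟩
  (q^ (2 * suc p) · slice k p) n
    ∎
  where
    open ≡-Reasoning
    E′ = edgeTerm (suc k)
    edge-shift : (x^ (2 * suc k) · E′) (suc p) n ≡ (x^ (2 * k) · x^ 1 · E′) p n
    edge-shift = cong (λ F → F n) (begin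
      (x^ (2 * suc k) · E′) (suc p)      ≡⟨ cong (λ t → (x^ t · E′) (suc p)) (ℕₚ.*-suc 2 k) ⟩
      (x^ (suc (1 + 2 * k)) · E′) (suc p) ≡⟨ cong (λ t → (x^ t · E′) p) (ℕₚ.+-comm 1 (2 * k)) ⟩
      (x^ (2 * k + 1) · E′) p            ≡⟨ sym (x^·-x^· (2 * k) 1 E′ p) ⟩
      (x^ (2 * k) · x^ 1 · E′) p         ∎)

bSer-step : ∀ p → 1-q^ (2 * suc p) · bSer (suc p)
                   ≗ q^ (2 * suc p) · bSer p +ˢ q^ (4 * p + 3) · bSer p
bSer-step p n = begin
  (1-q^ (2 * m) · bSer m) n
    ≡⟨ 1-q^·-sumTo (2 * m) m (λ k → slice k m) n ⟩
  sumTo m (λ k → (1-q^ (2 * m) · slice k m) n)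
    ≡⟨ sumTo-cong m (λ k _ → slice-step k p n) ⟩
  sumTo m (λ k → L k ℤ.+ M k ℤ.+ E k)
    ≡⟨ trans (sumTo-+ m _ E) (cong (ℤ._+ sumTo m E) (sumTo-+ m L M)) ⟩
  sumTo m L ℤ.+ sumTo m M ℤ.+ sumTo m E
    ≡⟨ cong₂ ℤ._+_ (cong₂ ℤ._+_ ΣL ΣM) ΣE ⟩
  sumTo p L ℤ.+ (q^ (4 * p + 3) · bSer p) n ℤ.+ sumTo p (E ∘ suc)
    ≡⟨ solve 3 (λ a b c → a :+ b :+ c := a :+ c :+ b) refl (sumTo p L) _ (sumTo p (E ∘ suc)) ⟩
  sumTo p L ℤ.+ sumTo p (E ∘ suc) ℤ.+ (q^ (4 * p + 3) · bSer p) n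
    ≡⟨ cong (ℤ._+ (q^ (4 * p + 3) · bSer p) n) carried ⟩
  (q^ (2 * m) · bSer p +ˢ q^ (4 * p + 3) · bSer p) n
    ∎
  where
    open ≡-Reasoning
    m = suc p
    L M E : ℕ → ℤ
    L k = (x^ (2 * k) · leadTerm k) p n
    M k = (q^ (4 * p + 3) · slice k p) n
    E k = (x^ (2 * k) · edgeTerm k) m n
    ΣL : sumTo m L ≡ sumTo p L
    ΣL = sumTo-dropLast p L (cong (λ F → F n) (x^·-below (2 * m) (leadTerm m) p (n<2*[1+n] p)))
    ΣM : sumTo m M ≡ (q^ (4 * p + 3) · bSer p) n
    ΣM = trans (sumTo-dropLast p M (trans (q^·-cong (4 * p + 3) slice-m-p≗0 n) (q^·-0ˢ (4 * p + 3) n)))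
               (sym (q^·-sumTo (4 * p + 3) p (λ k → slice k p) n))
      where
        slice-m-p≗0 : slice m p ≗ 0ˢ
        slice-m-p≗0 i = cong (λ F → F i) (x^·-below (2 * m) _ p (n<2*[1+n] p))
    ΣE : sumTo m E ≡ sumTo p (E ∘ suc)
    ΣE = trans (sumTo-suc p E)
               (trans (cong (ℤ._+ sumTo p (E ∘ suc)) E₀≡0) (ℤₚ.+-identityˡ _))
      where
        E₀≡0 : E 0 ≡ 0ℤ
        E₀≡0 = trans (q^·-cong m (1-q^0· (summand m 0)) n) (q^·-0ˢ m n)
    carried : sumTo p L ℤ.+ sumTo p (E ∘ suc) ≡ (q^ (2 * m) · bSer p) n
    carried = trans (sym (sumTo-+ p L (E ∘ suc)))
                    (trans (sumTo-cong p (λ k _ → slice-carry k p n))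
                           (sym (q^·-sumTo (2 * m) p (λ k → slice k p) n)))

-- The generating function of admissible partitions

minNext : ℕ → ℕ
minNext a = 2 + a + a % 2

ifAtLeast : ℕ → ℕ → ℤ → ℤ
ifAtLeast zero    a       x = x
ifAtLeast (suc s) zero    x = 0ℤ
ifAtLeast (suc s) (suc a) x = ifAtLeast s a x

ifEqual : ℕ → ℕ → ℤ → ℤ
ifEqual zero    zero    x = x
ifEqual zero    (suc a) x = 0ℤ
ifEqual (suc s) zero    x = 0ℤ
ifEqual (suc s) (suc a) x = ifEqual s a x

sumShifted : (ℕ → Ser) → Ser
sumShifted F n = sumTo n (λ a → F a (n ∸ a))

-- The generating function of the lists of m parts with first part at least s
-- in which each part is at least minNext of its predecessor.
admissibleGF : ℕ → ℕ → Ser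
admissibleGF s zero    = oneS
admissibleGF s (suc m) = sumShifted (λ a i → ifAtLeast s a (admissibleGF (minNext a) m i))

ifAtLeast-0ℤ : ∀ s a → ifAtLeast s a 0ℤ ≡ 0ℤ
ifAtLeast-0ℤ zero    a       = refl
ifAtLeast-0ℤ (suc s) zero    = refl
ifAtLeast-0ℤ (suc s) (suc a) = ifAtLeast-0ℤ s a

ifAtLeast-split : ∀ s a x → ifAtLeast s a x ≡ ifEqual s a x ℤ.+ ifAtLeast (suc s) a x
ifAtLeast-split zero    zero    x = sym (ℤₚ.+-identityʳ x)
ifAtLeast-split zero    (suc a) x = sym (ℤₚ.+-identityˡ x)
ifAtLeast-split (suc s) zero    x = refl
ifAtLeast-split (suc s) (suc a) x = ifAtLeast-split s a x

ifEqual-diagonal : ∀ s x → ifEqual s s x ≡ x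
ifEqual-diagonal zero    x = refl
ifEqual-diagonal (suc s) x = ifEqual-diagonal s x

ifEqual-offDiagonal : ∀ s a x → a ≢ s → ifEqual s a x ≡ 0ℤ
ifEqual-offDiagonal zero    zero    x a≢s = ⊥-elim (a≢s refl)
ifEqual-offDiagonal zero    (suc a) x a≢s = refl
ifEqual-offDiagonal (suc s) zero    x a≢s = refl
ifEqual-offDiagonal (suc s) (suc a) x a≢s = ifEqual-offDiagonal s a x (a≢s ∘ cong suc)

ifAtLeast-q^· : ∀ s a t (f : Ser) n → ifAtLeast s a ((q^ t · f) n) ≡ (q^ t · (ifAtLeast s a ∘ f)) n
ifAtLeast-q^· s a zero    f n       = refl
ifAtLeast-q^· s a (suc t) f zero    = ifAtLeast-0ℤ s a
ifAtLeast-q^· s a (suc t) f (suc n) = ifAtLeast-q^· s a t f n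

sumShifted-cong : ∀ {F G : ℕ → Ser} → (∀ a → F a ≗ G a) → sumShifted F ≗ sumShifted G
sumShifted-cong F≗G n = sumTo-cong n (λ a _ → F≗G a (n ∸ a))

sumShifted-ifEqual : ∀ s (F : ℕ → Ser) → sumShifted (λ a i → ifEqual s a (F a i)) ≗ q^ s · F s
sumShifted-ifEqual s F n with s ≤? n
... | yes s≤n = trans (sumTo-single n s s≤n (λ a _ a≢s → ifEqual-offDiagonal s a _ a≢s))
                      (trans (ifEqual-diagonal s _) (sym (q^·-above s (F s) n s≤n)))
... | no  s≰n = trans (sumTo-zero n (λ a a≤n → ifEqual-offDiagonal s a _ (λ { refl → s≰n a≤n })))
                      (sym (q^·-below s (F s) n (ℕₚ.≰⇒> s≰n)))

sumShifted-q^· : ∀ t (F : ℕ → Ser) → sumShifted (λ a → q^ t · F a) ≗ q^ t · sumShifted F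
sumShifted-q^· zero    F n       = refl
sumShifted-q^· (suc t) F zero    = refl
sumShifted-q^· (suc t) F (suc n) = begin
  sumTo (suc n) (λ a → (q^ suc t · F a) (suc n ∸ a))
    ≡⟨ sumTo-dropLast n _ (cong (λ i → (q^ suc t · F (suc n)) i) (ℕₚ.n∸n≡0 (suc n))) ⟩
  sumTo n (λ a → (q^ suc t · F a) (suc n ∸ a))
    ≡⟨ sumTo-cong n (λ a a≤n → cong (q^ suc t · F a) (ℕₚ.+-∸-assoc 1 a≤n)) ⟩
  sumShifted (λ a → q^ t · F a) n
    ≡⟨ sumShifted-q^· t F n ⟩
  (q^ t · sumShifted F) n
    ∎
  where open ≡-Reasoning

admissibleGF-split : ∀ s m → admissibleGF s (suc m)
                              ≗ q^ s · admissibleGF (minNext s) m +ˢ admissibleGF (suc s) (suc m)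
admissibleGF-split s m n = begin
  admissibleGF s (suc m) n
    ≡⟨ sumTo-cong n (λ a _ → ifAtLeast-split s a _) ⟩
  sumTo n (λ a → ifEqual s a (R a (n ∸ a)) ℤ.+ ifAtLeast (suc s) a (R a (n ∸ a)))
    ≡⟨ sumTo-+ n _ _ ⟩
  sumShifted (λ a i → ifEqual s a (R a i)) n ℤ.+ admissibleGF (suc s) (suc m) n
    ≡⟨ cong (ℤ._+ admissibleGF (suc s) (suc m) n) (sumShifted-ifEqual s R n) ⟩
  (q^ s · admissibleGF (minNext s) m +ˢ admissibleGF (suc s) (suc m)) n
    ∎
  where
    open ≡-Reasoning
    R = λ a → admissibleGF (minNext a) m

minNext-2+ : ∀ a → minNext (2 + a) ≡ 2 + minNext a
minNext-2+ a = cong (λ r → 4 + a + r) (trans (cong (_% 2) (ℕₚ.+-comm 2 a)) ([m+n]%n≡m%n a 2))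

admissibleGF-shift : ∀ s m → admissibleGF (3 + s) m ≗ q^ (2 * m) · admissibleGF (1 + s) m
admissibleGF-shift s zero    n                   = refl
admissibleGF-shift s (suc m) zero                = refl
admissibleGF-shift s (suc m) (suc zero)          =
  sym (q^·-below (2 * suc m) _ 1 (subst (1 <_) (sym (ℕₚ.*-suc 2 m)) (s≤s (s≤s z≤n))))
admissibleGF-shift s (suc m) (suc (suc n))       = begin
  admissibleGF (3 + s) (suc m) (2 + n)
    ≡⟨ trans (sumTo-suc (suc n) _) (trans (ℤₚ.+-identityˡ _) (trans (sumTo-suc n _) (ℤₚ.+-identityˡ _))) ⟩
  sumShifted (λ a i → ifAtLeast (1 + s) a (admissibleGF (minNext (2 + a)) m i)) n
    ≡⟨ sumShifted-cong (λ a i → cong (ifAtLeast (1 + s) a) (shifted a i)) n ⟩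
  sumShifted (λ a i → ifAtLeast (1 + s) a ((q^ (2 * m) · R a) i)) n
    ≡⟨ sumShifted-cong (λ a → ifAtLeast-q^· (1 + s) a (2 * m) (R a)) n ⟩
  sumShifted (λ a → q^ (2 * m) · (ifAtLeast (1 + s) a ∘ R a)) n
    ≡⟨ sumShifted-q^· (2 * m) (λ a → ifAtLeast (1 + s) a ∘ R a) n ⟩
  (q^ (2 * m) · admissibleGF (1 + s) (suc m)) n
    ≡⟨ q^·-exponent (admissibleGF (1 + s) (suc m)) (sym (ℕₚ.*-suc 2 m)) (2 + n) ⟩
  (q^ (2 * suc m) · admissibleGF (1 + s) (suc m)) (2 + n)
    ∎
  where
    open ≡-Reasoning
    R = λ a → admissibleGF (minNext a) m
    shifted : ∀ a → admissibleGF (minNext (2 + a)) m ≗ q^ (2 * m) · R a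
    shifted a i = trans (cong (λ r → admissibleGF r m i) (minNext-2+ a))
                        (admissibleGF-shift (suc (a + a % 2)) m i)

admissibleGF-1 : ∀ p → admissibleGF 1 (suc p) ≗ q^ (2 * p + 1) · admissibleGF 2 p +ˢ admissibleGF 2 (suc p)
admissibleGF-1 p n = trans (admissibleGF-split 1 p n) (cong (ℤ._+ admissibleGF 2 (suc p) n) (begin
  (q^ 1 · admissibleGF 4 p) n                 ≡⟨ q^·-cong 1 (admissibleGF-shift 1 p) n ⟩
  (q^ 1 · q^ (2 * p) · admissibleGF 2 p) n    ≡⟨ q^·-q^· 1 (2 * p) _ n ⟩
  (q^ (1 + 2 * p) · admissibleGF 2 p) n       ≡⟨ q^·-exponent _ (ℕₚ.+-comm 1 (2 * p)) n ⟩
  (q^ (2 * p + 1) · admissibleGF 2 p) n       ∎))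
  where open ≡-Reasoning

admissibleGF-1≗plusXqDilated : ∀ m → admissibleGF 1 m ≗ plusXqDilated (admissibleGF 2) m
admissibleGF-1≗plusXqDilated zero    n = sym (ℤₚ.+-identityʳ (oneS n))
admissibleGF-1≗plusXqDilated (suc p) n =
  trans (admissibleGF-1 p n) (ℤₚ.+-comm ((q^ (2 * p + 1) · admissibleGF 2 p) n) (admissibleGF 2 (suc p) n))

admissibleGF-2-step : ∀ p → 1-q^ (2 * suc p) · admissibleGF 2 (suc p)
                            ≗ q^ (2 * suc p) · admissibleGF 2 p +ˢ q^ (4 * p + 3) · admissibleGF 2 p
admissibleGF-2-step p n = begin
  R₂′ n ℤ.- (q^ 2m · R₂′) n
    ≡⟨ cong (ℤ._- (q^ 2m · R₂′) n) (trans (admissibleGF-split 2 p n) (cong₂ ℤ._+_ first second)) ⟩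
  (q^ 2m · R₂) n ℤ.+ ((q^ (4 * p + 3) · R₂) n ℤ.+ (q^ 2m · R₂′) n) ℤ.- (q^ 2m · R₂′) n
    ≡⟨ solve 3 (λ a b c → a :+ (b :+ c) :- c := a :+ b) refl
               ((q^ 2m · R₂) n) ((q^ (4 * p + 3) · R₂) n) ((q^ 2m · R₂′) n) ⟩
  (q^ 2m · R₂ +ˢ q^ (4 * p + 3) · R₂) n
    ∎
  where
    open ≡-Reasoning
    2m  = 2 * suc p
    R₂  = admissibleGF 2 p
    R₂′ = admissibleGF 2 (suc p)
    first : (q^ 2 · admissibleGF 4 p) n ≡ (q^ 2m · R₂) n
    first = trans (q^·-cong 2 (admissibleGF-shift 1 p) n)
                  (trans (q^·-q^· 2 (2 * p) R₂ n) (q^·-exponent R₂ (sym (ℕₚ.*-suc 2 p)) n))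
    second : admissibleGF 3 (suc p) n ≡ (q^ (4 * p + 3) · R₂) n ℤ.+ (q^ 2m · R₂′) n
    second = begin
      admissibleGF 3 (suc p) n
        ≡⟨ admissibleGF-shift 0 (suc p) n ⟩
      (q^ 2m · admissibleGF 1 (suc p)) n
        ≡⟨ q^·-cong 2m (admissibleGF-1 p) n ⟩
      (q^ 2m · (q^ (2 * p + 1) · R₂ +ˢ R₂′)) n
        ≡⟨ q^·-+ˢ 2m _ R₂′ n ⟩
      (q^ 2m · q^ (2 * p + 1) · R₂) n ℤ.+ (q^ 2m · R₂′) n
        ≡⟨ cong (ℤ._+ (q^ 2m · R₂′) n) (trans (q^·-q^· 2m _ R₂ n) (q^·-exponent R₂ (exponent p) n)) ⟩
      (q^ (4 * p + 3) · R₂) n ℤ.+ (q^ 2m · R₂′) n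
        ∎
      where
        exponent : ∀ p → 2 * suc p + (2 * p + 1) ≡ 4 * p + 3
        exponent = solve-∀

1-q^·-injective : ∀ k {f g h} → 1-q^ (suc k) · f ≗ h → 1-q^ (suc k) · g ≗ h → f ≗ g
1-q^·-injective k {f} {g} {h} f-eq g-eq = ≗-by-strong-induction λ n ih → begin
  f n                              ≡⟨ isolate f-eq n ⟩
  h n ℤ.+ (q^ suc k · f) n         ≡⟨ cong (λ x → h n ℤ.+ x) (q^1+·-earlier k n ih) ⟩
  h n ℤ.+ (q^ suc k · g) n         ≡⟨ sym (isolate g-eq n) ⟩
  g n                              ∎
  where
    open ≡-Reasoning
    isolate : ∀ {u} → 1-q^ (suc k) · u ≗ h → ∀ n → u n ≡ h n ℤ.+ (q^ suc k · u) n
    isolate {u} eq n = trans (solve 2 (λ a b → a := (a :- b) :+ b) refl (u n) ((q^ suc k · u) n))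
                             (cong (ℤ._+ (q^ suc k · u) n) (eq n))

bSer-zero : bSer 0 ≗ oneS
bSer-zero n =
  trans (mulS-congˡ I₄ (invS-poch-zero 1 1) n) (trans (mulS-identityˡ I₄ n) (invS-poch-zero 4 4 n))
  where I₄ = invS (poch 4 4 0)

admissibleGF-2≗bSer : ∀ p → admissibleGF 2 p ≗ bSer p
admissibleGF-2≗bSer zero    n = sym (bSer-zero n)
admissibleGF-2≗bSer (suc p) = 1-q^·-injective _ (admissibleGF-2-step p) λ n →
  trans (bSer-step p n) (sym (cong₂ ℤ._+_ (q^·-cong (2 * suc p) (admissibleGF-2≗bSer p) n)
                                          (q^·-cong (4 * p + 3) (admissibleGF-2≗bSer p) n)))

-- Counting admissible lists

count : (List ℕ → Bool) → List (List ℕ) → ℕ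
count p L = length (filterᵇ p L)

count-++ : ∀ p xs ys → count p (xs ++ ys) ≡ count p xs + count p ys
count-++ p xs ys = trans (cong length (Listₚ.filter-++ (T? ∘ p) xs ys)) (Listₚ.length-++ (filterᵇ p xs))

count-map-∷ : ∀ p a L → count p (map (a ∷_) L) ≡ count (p ∘ (a ∷_)) L
count-map-∷ p a []      = refl
count-map-∷ p a (l ∷ L) with p (a ∷ l)
... | true  = cong suc (count-map-∷ p a L)
... | false = count-map-∷ p a L

count-cong : ∀ {p q} → (∀ l → p l ≡ q l) → ∀ L → count p L ≡ count q L
count-cong         p≗q []      = refl
count-cong {p} {q} p≗q (l ∷ L) with p l | q l | p≗q l
... | true  | .true  | refl = cong suc (count-cong p≗q L)
... | false | .false | refl = count-cong p≗q L

count-none : ∀ {p} → (∀ l → p l ≡ false) → ∀ L → count p L ≡ 0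
count-none     never []      = refl
count-none {p} never (l ∷ L) with p l | never l
... | .false | refl = count-none never L

count-concatMap : ∀ p (h : ℕ → List (List ℕ)) (g : ℕ → ℕ) k →
                  + count p (concatMap h (applyUpTo g (suc k))) ≡ sumTo k (λ i → + count p (h (g i)))
count-concatMap p h g zero    = cong +_ (trans (count-++ p (h (g 0)) []) (ℕₚ.+-identityʳ _))
count-concatMap p h g (suc k) =
  trans (cong +_ (count-++ p (h (g 0)) _))
        (trans (cong (λ x → + count p (h (g 0)) ℤ.+ x) (count-concatMap p h (g ∘ suc) k))
               (sym (sumTo-suc k (λ i → + count p (h (g i))))))

count-allLists-suc : ∀ p m k → + count p (allLists (suc m) (suc k))
                               ≡ sumTo k (λ i → + count (p ∘ (suc i ∷_)) (allLists m (suc k)))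
count-allLists-suc p m k = begin
  + count p (concatMap extend (map suc (upTo (suc k))))
    ≡⟨ cong (λ L → + count p (concatMap extend L)) (Listₚ.map-applyUpTo (λ i → i) suc (suc k)) ⟩
  + count p (concatMap extend (applyUpTo suc (suc k)))
    ≡⟨ count-concatMap p extend suc k ⟩
  sumTo k (λ i → + count p (map (suc i ∷_) (allLists m (suc k))))
    ≡⟨ sumTo-cong k (λ i _ → cong +_ (count-map-∷ p (suc i) (allLists m (suc k)))) ⟩
  sumTo k (λ i → + count (p ∘ (suc i ∷_)) (allLists m (suc k)))
    ∎
  where
    open ≡-Reasoning
    extend = λ a → map (a ∷_) (allLists m (suc k))

<ᵇ-suc : ∀ k j → (k <ᵇ suc j) ≡ (k ≤ᵇ j)
<ᵇ-suc zero    j = refl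
<ᵇ-suc (suc k) j = refl

+-≤ᵇ-+ : ∀ a x y → (a + x ≤ᵇ a + y) ≡ (x ≤ᵇ y)
+-≤ᵇ-+ zero    x y = refl
+-≤ᵇ-+ (suc a) x y = trans (<ᵇ-suc (a + x) (a + y)) (+-≤ᵇ-+ a x y)

≤ᵇ-false : ∀ x y → y < x → (x ≤ᵇ y) ≡ false
≤ᵇ-false x y y<x with x ≤ᵇ y in eq
... | false = refl
... | true  = ⊥-elim (ℕₚ.<⇒≱ y<x (ℕₚ.≤ᵇ⇒≤ x y (subst T (sym eq) tt)))

parity : ∀ a → a % 2 ≡ 0 ⊎ a % 2 ≡ 1
parity a with a % 2 | m%n<n a 2
... | 0           | _               = inj₁ refl
... | 1           | _               = inj₂ refl
... | suc (suc _) | s≤s (s≤s ())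

minNext≡ : ∀ a → minNext a ≡ a + (2 + a % 2)
minNext≡ a = trans (cong (_+ a % 2) (ℕₚ.+-comm 2 a)) (ℕₚ.+-assoc a 2 (a % 2))

gapOK-offset : ∀ a d → gapOK a (a + d) ≡ (minNext a ≤ᵇ a + d)
gapOK-offset a d =
  trans (cong₂ (λ x y → x ∧ (y ∨ (isEven a ∧ isEven (a + d)))) (+-≤ᵇ-+ a 2 d) (+-≤ᵇ-+ a 3 d))
        (trans (offset d) (sym (trans (cong (_≤ᵇ a + d) (minNext≡ a)) (+-≤ᵇ-+ a (2 + a % 2) d))))
  where
    a+2%2≡a%2 : (a + 2) % 2 ≡ a % 2
    a+2%2≡a%2 = [m+n]%n≡m%n a 2
    offset : ∀ d → (2 ≤ᵇ d) ∧ ((3 ≤ᵇ d) ∨ (isEven a ∧ isEven (a + d))) ≡ (2 + a % 2 ≤ᵇ d)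
    offset 0 = refl
    offset 1 = refl
    offset 2 rewrite a+2%2≡a%2 with parity a
    ... | inj₁ even rewrite even = refl
    ... | inj₂ odd  rewrite odd  = refl
    offset (suc (suc (suc e))) with parity a
    ... | inj₁ even rewrite even = refl
    ... | inj₂ odd  rewrite odd  = refl

gapOK≡minNext≤ᵇ : ∀ a b → gapOK a b ≡ (minNext a ≤ᵇ b)
gapOK≡minNext≤ᵇ a b with a ≤? b
... | yes a≤b = subst (λ c → gapOK a c ≡ (minNext a ≤ᵇ c)) (ℕₚ.m+[n∸m]≡n a≤b) (gapOK-offset a (b ∸ a))
... | no  a≰b rewrite ≤ᵇ-false (a + 2) b (ℕₚ.<-≤-trans (ℕₚ.≰⇒> a≰b) (ℕₚ.m≤m+n a 2)) =
  sym (≤ᵇ-false (minNext a) b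
                (ℕₚ.<-≤-trans (ℕₚ.≰⇒> a≰b) (subst (a ≤_) (sym (minNext≡ a)) (ℕₚ.m≤m+n a _))))

headAtLeast : ℕ → List ℕ → Bool
headAtLeast s []      = true
headAtLeast s (a ∷ _) = s ≤ᵇ a

admissible : ℕ → ℕ → List ℕ → Bool
admissible s n l = headAtLeast s l ∧ good l ∧ (sum l ≡ᵇ n)

good-∷ : ∀ a l → good (a ∷ l) ≡ headAtLeast (minNext a) l ∧ good l
good-∷ a []      = refl
good-∷ a (b ∷ l) = cong (_∧ good (b ∷ l)) (gapOK≡minNext≤ᵇ a b)

+-≡ᵇ : ∀ a x n → a ≤ n → (a + x ≡ᵇ n) ≡ (x ≡ᵇ n ∸ a)
+-≡ᵇ zero    x n       _         = refl
+-≡ᵇ (suc a) x (suc n) (s≤s a≤n) = +-≡ᵇ a x n a≤n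

+-≡ᵇ-> : ∀ a x n → n < a → (a + x ≡ᵇ n) ≡ false
+-≡ᵇ-> (suc a) x zero    _         = refl
+-≡ᵇ-> (suc a) x (suc n) (s≤s n<a) = +-≡ᵇ-> a x n n<a

admissible-∷ : ∀ s n a l → a ≤ n → admissible s n (a ∷ l) ≡ (s ≤ᵇ a) ∧ admissible (minNext a) (n ∸ a) l
admissible-∷ s n a l a≤n = cong (λ b → (s ≤ᵇ a) ∧ b) (begin
  good (a ∷ l) ∧ (a + sum l ≡ᵇ n)
    ≡⟨ cong₂ _∧_ (good-∷ a l) (+-≡ᵇ a (sum l) n a≤n) ⟩
  (headAtLeast (minNext a) l ∧ good l) ∧ (sum l ≡ᵇ n ∸ a)
    ≡⟨ 𝔹ₚ.∧-assoc (headAtLeast (minNext a) l) _ _ ⟩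
  admissible (minNext a) (n ∸ a) l                         ∎)
  where open ≡-Reasoning

admissible-∷-> : ∀ s n a l → n < a → admissible s n (a ∷ l) ≡ false
admissible-∷-> s n a l n<a rewrite +-≡ᵇ-> a (sum l) n n<a =
  trans (cong (λ b → (s ≤ᵇ a) ∧ b) (𝔹ₚ.∧-zeroʳ (good (a ∷ l)))) (𝔹ₚ.∧-zeroʳ (s ≤ᵇ a))

count-ifAtLeast : ∀ s a q L → + count (λ l → (s ≤ᵇ a) ∧ q l) L ≡ ifAtLeast s a (+ count q L)
count-ifAtLeast zero          a       q L = refl
count-ifAtLeast (suc s)       zero    q L = cong +_ (count-none (λ _ → refl) L)
count-ifAtLeast (suc zero)    (suc a) q L = count-ifAtLeast zero a q L
count-ifAtLeast (suc (suc s)) (suc a) q L = count-ifAtLeast (suc s) a q L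

count-admissible : ∀ m s n k → n ≤ k →
                   + count (admissible (suc s) n) (allLists m k) ≡ admissibleGF (suc s) m n
count-admissible zero    s zero    k       _     = refl
count-admissible zero    s (suc n) k       _     = refl
count-admissible (suc m) s n       zero    z≤n   = refl
count-admissible (suc m) s n       (suc k) n≤1+k = begin
  + count P (allLists (suc m) (suc k))
    ≡⟨ count-allLists-suc P m k ⟩
  sumTo k (c ∘ suc)
    ≡⟨ sym (trans (sumTo-suc k c) (trans (cong (ℤ._+ sumTo k (c ∘ suc)) c₀≡0) (ℤₚ.+-identityˡ _))) ⟩
  sumTo (suc k) c
    ≡⟨ cong (λ N → sumTo N c) (sym (ℕₚ.m∸n+n≡m n≤1+k)) ⟩
  sumTo (suc k ∸ n + n) c
    ≡⟨ sumTo-extend (suc k ∸ n) n c (λ a n<a _ → c-above a n<a) ⟩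
  sumTo n c
    ≡⟨ sumTo-cong n c-within ⟩
  admissibleGF (suc s) (suc m) n
    ∎
  where
    open ≡-Reasoning
    P = admissible (suc s) n
    L = allLists m (suc k)
    c : ℕ → ℤ
    c a = + count (P ∘ (a ∷_)) L
    c₀≡0 : c 0 ≡ 0ℤ
    c₀≡0 = cong +_ (count-none (λ _ → refl) L)
    c-above : ∀ a → n < a → c a ≡ 0ℤ
    c-above a n<a = cong +_ (count-none (λ l → admissible-∷-> (suc s) n a l n<a) L)
    c-within : ∀ a → a ≤ n → c a ≡ ifAtLeast (suc s) a (admissibleGF (minNext a) m (n ∸ a))
    c-within a a≤n = begin
      + count (P ∘ (a ∷_)) L
        ≡⟨ cong +_ (count-cong (λ l → admissible-∷ (suc s) n a l a≤n) L) ⟩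
      + count (λ l → (suc s ≤ᵇ a) ∧ admissible (minNext a) (n ∸ a) l) L
        ≡⟨ count-ifAtLeast (suc s) a _ L ⟩
      ifAtLeast (suc s) a (+ count (admissible (minNext a) (n ∸ a)) L)
        ≡⟨ cong (ifAtLeast (suc s) a)
                (count-admissible m (suc (a + a % 2)) (n ∸ a) (suc k) (ℕₚ.≤-trans (ℕₚ.m∸n≤m n a) n≤1+k)) ⟩
      ifAtLeast (suc s) a (admissibleGF (minNext a) m (n ∸ a))
        ∎

D≡admissibleGF : ∀ n m → + D n m ≡ admissibleGF 1 m n
D≡admissibleGF zero    zero    = refl
D≡admissibleGF (suc n) zero    = refl
D≡admissibleGF zero    (suc m) = refl
D≡admissibleGF (suc n) (suc m) = begin
  + D (suc n) (suc m)
    ≡⟨ count-allLists-suc _ m n ⟩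
  sumTo n (λ i → + count (λ l → (sum (suc i ∷ l) ≡ᵇ suc n) ∧ good (suc i ∷ l)) L)
    ≡⟨ sumTo-cong n (λ i _ → cong +_ (count-cong (λ l → 𝔹ₚ.∧-comm _ (good (suc i ∷ l))) L)) ⟩
  sumTo n (λ i → + count (admissible 1 (suc n) ∘ (suc i ∷_)) L)
    ≡⟨ sym (count-allLists-suc _ m n) ⟩
  + count (admissible 1 (suc n)) (allLists (suc m) (suc n))
    ≡⟨ count-admissible (suc m) 0 (suc n) (suc n) ℕₚ.≤-refl ⟩
  admissibleGF 1 (suc m) (suc n)
    ∎
  where
    open ≡-Reasoning
    L = allLists m (suc n)

theorem15 : (n m : ℕ) → + D n m ≡ rhsCoeff m n
theorem15 n m = begin
  + D n m                              ≡⟨ D≡admissibleGF n m ⟩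
  admissibleGF 1 m n                   ≡⟨ admissibleGF-1≗plusXqDilated m n ⟩
  plusXqDilated (admissibleGF 2) m n   ≡⟨ plusXqDilated-cong admissibleGF-2≗bSer m n ⟩
  plusXqDilated bSer m n               ≡⟨ sym (rhsCoeff-decompose m n) ⟩
  rhsCoeff m n                         ∎
  where open ≡-Reasoning
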